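{- Let $k$ be a positive integer and $\alpha,\beta\in\mathfrak{R}=\mathbb{Z}_{2^k}[x]/\langle x^2+x+1\rangle$. If $\alpha=\beta$, then $H_{4^k}(\alpha,\beta)$ is a $\overrightarrow{C}_3$-factor of $\overrightarrow{C}_{(4^k:3)}$. If $\alpha-\beta\in\{\pm1,\pm x,\pm x\pm 1\}$, then $H_{4^k}(\alpha,\beta)$ is a $\overrightarrow{C}_{3\cdot 2^k}$-factor of $\overrightarrow{C}_{(4^k:3)}$.
   Context: $\overrightarrow{C}_{(4^k:3)}$ is the directed graph with three parts $G_0,G_1,G_2$, each of size $4^k$, with an arc from every vertex of $G_i$ to every vertex of $G_{i+1}$ (indices mod 3). The vertices of each part are labeled by the elements of $\mathfrak{R}$ (elements $a+bx$, $a,b\in\mathbb{Z}_{2^k}$). For $\gamma\in\mathfrak{R}$ let $f_\gamma(y)=xy+\gamma$. $H_{4^k}(\alpha,\beta)$ is the spanning subgraph whose arcs go from each $y$ in $G_0$ (resp. $G_1$) to $f_\alpha(y)$ in $G_1$ (resp. $G_2$), and from each $y$ in $G_2$ to $f_\beta(y)$ in $G_0$. A $\overrightarrow{C}_\ell$-factor is a spanning subgraph that is a vertex-disjoint union of directed cycles of length $\ell$. -}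

module Defs where

open import Data.Nat as ℕ using (ℕ; zero; suc; _^_; NonZero)
open import Data.Nat.Properties using (m^n≢0)
open import Data.Nat.DivMod using (_%_; m%n<n)
open import Data.Fin using (Fin; zero; suc; toℕ; fromℕ<)
open import Data.Product using (Σ; _×_; _,_; proj₁; proj₂; ∃)
open import Data.List using (List; _∷_; [])
open import Data.List.Membership.Propositional using (_∈_)
open import Relation.Binary.PropositionalEquality using (_≡_)
open import Relation.Nullary using (yes; no)
open import Function.Bundles using (_⇔_)

csucc : ∀ {n} → Fin n → Fin n
csucc {suc n} i with suc (toℕ i) ℕ.<? suc n
... | yes p = fromℕ< p
... | no _  = zero

Zmod : ℕ → Set
Zmod k = Fin (2 ^ k)

module _ (k : ℕ) where
  private
    M : ℕ
    M = 2 ^ k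
    instance
      M≢0 : NonZero M
      M≢0 = m^n≢0 2 k

  red : ℕ → Zmod k
  red n = fromℕ< (m%n<n n M)

  zeroZ oneZ : Zmod k
  zeroZ = red 0
  oneZ  = red 1

  addZ mulZ : Zmod k → Zmod k → Zmod k
  addZ a b = red (toℕ a ℕ.+ toℕ b)
  mulZ a b = red (toℕ a ℕ.* toℕ b)

  negZ : Zmod k → Zmod k
  negZ a = red (M ℕ.∸ toℕ a)

  subZ : Zmod k → Zmod k → Zmod k
  subZ a b = addZ a (negZ b)

-- 𝔑 = ℤ_{2^k}[x]/⟨x²+x+1⟩ ; the pair (a , b) denotes a + b x.

𝔑 : ℕ → Set
𝔑 k = Zmod k × Zmod k

module _ {k : ℕ} where
  infixl 6 _+R_ _-R_
  infixl 7 _*R_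

  _+R_ : 𝔑 k → 𝔑 k → 𝔑 k
  (a , b) +R (c , d) = addZ k a c , addZ k b d

  -R_ : 𝔑 k → 𝔑 k
  -R (a , b) = negZ k a , negZ k b

  _-R_ : 𝔑 k → 𝔑 k → 𝔑 k
  u -R v = u +R (-R v)

  -- (a + b x)(c + d x) = ac + (ad + bc) x + bd x²,  with x² = -1 - x
  _*R_ : 𝔑 k → 𝔑 k → 𝔑 k
  (a , b) *R (c , d) =
    subZ k (mulZ k a c) (mulZ k b d) ,
    subZ k (addZ k (mulZ k a d) (mulZ k b c)) (mulZ k b d)

  1R xR : 𝔑 k
  1R = oneZ k , zeroZ k
  xR = zeroZ k , oneZ k

  f : 𝔑 k → 𝔑 k → 𝔑 k
  f γ y = xR *R y +R γ

  specialDiffs : List (𝔑 k)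
  specialDiffs =
    1R ∷ (-R 1R) ∷ xR ∷ (-R xR) ∷
    (xR +R 1R) ∷ (xR -R 1R) ∷ ((-R xR) +R 1R) ∷ ((-R xR) -R 1R) ∷ []

-- Vertices of C_(4^k:3): a part index i ∈ {0,1,2} and a label in 𝔑.
Vtx : ℕ → Set
Vtx k = Fin 3 × 𝔑 k

-- Arcs of C_(4^k:3): every vertex of G_i to every vertex of G_{i+1}.
C4k3 : (k : ℕ) → Vtx k → Vtx k → Set
C4k3 k (i , y) (j , z) = j ≡ csucc i

γH : ∀ {k} → 𝔑 k → 𝔑 k → Fin 3 → 𝔑 k
γH α β zero = α
γH α β (suc zero) = α
γH α β (suc (suc zero)) = β

H : (k : ℕ) → 𝔑 k → 𝔑 k → Vtx k → Vtx k → Set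
H k α β (i , y) (j , z) = j ≡ csucc i × z ≡ f {k} (γH {k} α β i) y

IsSpanningSubgraph : {V : Set} → (V → V → Set) → (V → V → Set) → Set
IsSpanningSubgraph {V} A B = ∀ (u v : V) → A u v → B u v

-- A digraph (V, A) is a vertex-disjoint union of directed ℓ-cycles covering
-- all vertices: there are m cycles c_j = (c_j 0 → c_j 1 → … → c_j (ℓ-1) → c_j 0)
-- such that each vertex occurs at exactly one position (j , i) (so the cycles
-- are vertex-disjoint, spanning, and each cycle has ℓ distinct vertices), and
-- the arcs of A are exactly the arcs of these cycles.
record IsCycleUnion {V : Set} (A : V → V → Set) (ℓ : ℕ) : Set where
  field
    m     : ℕ
    cyc   : Fin m → Fin ℓ → V
    cover : ∀ (v : V) → Σ (Fin m × Fin ℓ) λ p →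
              (cyc (proj₁ p) (proj₂ p) ≡ v) ×
              (∀ (q : Fin m × Fin ℓ) → cyc (proj₁ q) (proj₂ q) ≡ v → q ≡ p)
    arcs  : ∀ (u v : V) →
              A u v ⇔ (Σ (Fin m × Fin ℓ) λ p →
                         (u ≡ cyc (proj₁ p) (proj₂ p)) ×
                         (v ≡ cyc (proj₁ p) (csucc (proj₂ p))))

IsCFactorOf : {V : Set} → (ℓ : ℕ) → (V → V → Set) → (V → V → Set) → Set
IsCFactorOf ℓ A B = IsSpanningSubgraph A B × IsCycleUnion A ℓ

-- H_{4^k}(α,β) is the graph of  next (i , y) = (i + 1 , f_{γ_i} y)  on Fin 3 × 𝔑,
-- with γ₀ = γ₁ = α, γ₂ = β.  As x³ = 1 and x² + x = -1, the first return map
-- to layer G₀ is the translation f_β (f_α (f_α z)) = z + (β - α), and every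
-- cycle of length N of the return map lifts to a cycle of length 3N of next.
-- For α = β the return map is the identity (4^k cycles of length 3); for
-- α - β ∈ {±1, ±x, ±x±1} one coordinate e of β - α has e² = 1, so translation
-- by β - α has 2^k cycles of length 2^k.
module Submission where

open import Defs
open import Data.Nat using (ℕ; _*_; _^_; _≥_)
open import Data.Product using (_×_)
open import Data.List.Membership.Propositional using (_∈_)
open import Relation.Binary.PropositionalEquality using (_≡_)

open import Data.Nat as ℕ using (zero; suc; NonZero)
import Data.Nat.Properties as ℕP
open import Data.Nat.DivMod using (_%_; _/_; m≡m%n+[m/n]*n)
open import Data.Integer as ℤ using (ℤ; +_; -[1+_]; _+_; -_) renaming (_*_ to _*ℤ_)
import Data.Integer.Properties as ℤP
open import Data.Integer.Tactic.RingSolver using (solve-∀)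
import Data.Integer.Solver
open import Data.Fin using (Fin; zero; suc; toℕ; combine; remQuot)
open import Data.Fin.Properties
  using (toℕ-fromℕ<; toℕ-injective; toℕ<n; toℕ-combine; remQuot-combine; combine-remQuot)
open import Data.Product using (Σ; _,_; proj₁; proj₂; swap; uncurry)
open import Data.Sum using (_⊎_; inj₁; inj₂)
open import Data.Vec using (Vec; []; _∷_; lookup; map)
open import Data.Vec.Properties using (lookup-map)
open import Data.List.Relation.Unary.Any using (here; there)
open import Data.Empty using (⊥-elim)
open import Relation.Nullary using (¬_; yes; no)
open import Function.Bundles using (_⇔_; mk⇔; Equivalence)
open import Relation.Binary.PropositionalEquality
  using (refl; sym; trans; cong; cong₂; subst; module ≡-Reasoning)

module S = Data.Integer.Solver.+-*-Solver
open S using (Polynomial; con; var; _:+_; _:*_; :-_)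

csucc-spec : ∀ {n} (i : Fin n) →
  (toℕ (csucc i) ≡ suc (toℕ i)) ⊎ (toℕ (csucc i) ≡ 0 × suc (toℕ i) ≡ n)
csucc-spec {suc n} i with suc (toℕ i) ℕ.<? suc n
... | yes p = inj₁ (toℕ-fromℕ< p)
... | no ¬p = inj₂ (refl , ℕP.≤-antisym (toℕ<n i) (ℕP.≮⇒≥ ¬p))

csucc-increment : ∀ {n} (i j : Fin n) → toℕ j ≡ suc (toℕ i) → csucc i ≡ j
csucc-increment i j j≡1+i with csucc-spec i
... | inj₁ e = toℕ-injective (trans e (sym j≡1+i))
... | inj₂ (_ , last) = ⊥-elim (ℕP.<-irrefl (trans j≡1+i last) (toℕ<n j))

csucc-wrap : ∀ {n} (i z : Fin n) → toℕ z ≡ 0 → suc (toℕ i) ≡ n → csucc i ≡ z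
csucc-wrap i z z≡0 last with csucc-spec i
... | inj₁ e = ⊥-elim (ℕP.<-irrefl (trans e last) (toℕ<n (csucc i)))
... | inj₂ (e , _) = toℕ-injective (trans e (sym z≡0))

-- Reading combine n r ∈ Fin (N * d) as the two-digit number n·d + r, csucc
-- increments the low digit r when r is not the last digit ...
csucc-combine-digit : ∀ {N d} (n : Fin N) (r s : Fin d) →
  toℕ s ≡ suc (toℕ r) → csucc (combine n r) ≡ combine n s
csucc-combine-digit {d = d} n r s s≡1+r = csucc-increment (combine n r) (combine n s) (begin
  toℕ (combine n s)           ≡⟨ toℕ-combine n s ⟩
  d * toℕ n ℕ.+ toℕ s         ≡⟨ cong (d * toℕ n ℕ.+_) s≡1+r ⟩
  d * toℕ n ℕ.+ suc (toℕ r)   ≡⟨ ℕP.+-suc (d * toℕ n) (toℕ r) ⟩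
  suc (d * toℕ n ℕ.+ toℕ r)   ≡⟨ cong suc (toℕ-combine n r) ⟨
  suc (toℕ (combine n r))     ∎)
  where open ≡-Reasoning

combine-overflow : ∀ {N d} (n : Fin N) (r : Fin d) →
  suc (toℕ r) ≡ d → suc (toℕ (combine n r)) ≡ d * suc (toℕ n)
combine-overflow {d = d} n r last = begin
  suc (toℕ (combine n r))     ≡⟨ cong suc (toℕ-combine n r) ⟩
  suc (d * toℕ n ℕ.+ toℕ r)   ≡⟨ ℕP.+-suc (d * toℕ n) (toℕ r) ⟨
  d * toℕ n ℕ.+ suc (toℕ r)   ≡⟨ cong (d * toℕ n ℕ.+_) last ⟩
  d * toℕ n ℕ.+ d             ≡⟨ ℕP.+-comm (d * toℕ n) d ⟩
  d ℕ.+ d * toℕ n             ≡⟨ ℕP.*-suc d (toℕ n) ⟨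
  d * suc (toℕ n)             ∎
  where open ≡-Reasoning

csucc-combine-carry : ∀ {N d} (n : Fin N) (r z : Fin d) →
  toℕ z ≡ 0 → suc (toℕ r) ≡ d → csucc (combine n r) ≡ combine (csucc n) z
csucc-combine-carry {N} {d} n r z z≡0 last with csucc-spec n
... | inj₁ e = csucc-increment (combine n r) (combine (csucc n) z) (begin
  toℕ (combine (csucc n) z)          ≡⟨ toℕ-combine (csucc n) z ⟩
  d * toℕ (csucc n) ℕ.+ toℕ z        ≡⟨ cong₂ (λ a b → d * a ℕ.+ b) e z≡0 ⟩
  d * suc (toℕ n) ℕ.+ 0              ≡⟨ ℕP.+-identityʳ _ ⟩
  d * suc (toℕ n)                    ≡⟨ combine-overflow n r last ⟨
  suc (toℕ (combine n r))            ∎)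
  where open ≡-Reasoning
... | inj₂ (e , n-last) = csucc-wrap (combine n r) (combine (csucc n) z)
  (begin
    toℕ (combine (csucc n) z)   ≡⟨ toℕ-combine (csucc n) z ⟩
    d * toℕ (csucc n) ℕ.+ toℕ z ≡⟨ cong₂ (λ a b → d * a ℕ.+ b) e z≡0 ⟩
    d * 0 ℕ.+ 0                 ≡⟨ cong (ℕ._+ 0) (ℕP.*-zeroʳ d) ⟩
    0                           ∎)
  (begin
    suc (toℕ (combine n r))     ≡⟨ combine-overflow n r last ⟩
    d * suc (toℕ n)             ≡⟨ cong (d *_) n-last ⟩
    d * N                       ≡⟨ ℕP.*-comm d N ⟩
    N * d                       ∎)
  where open ≡-Reasoning

csucc-digits : ∀ {N} → Fin N → Fin 3 → Fin N × Fin 3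
csucc-digits n zero = n , suc zero
csucc-digits n (suc zero) = n , suc (suc zero)
csucc-digits n (suc (suc zero)) = csucc n , zero

csucc-combine : ∀ {N} (n : Fin N) (r : Fin 3) →
  csucc (combine n r) ≡ uncurry combine (csucc-digits n r)
csucc-combine n zero = csucc-combine-digit n zero (suc zero) refl
csucc-combine n (suc zero) = csucc-combine-digit n (suc zero) (suc (suc zero)) refl
csucc-combine n (suc (suc zero)) = csucc-combine-carry n (suc (suc zero)) zero refl refl

private
  zero-multiple : ∀ x m → x ≡ x + + 0 *ℤ m
  zero-multiple = solve-∀
  flip-multiple : ∀ y q m → y ≡ (y + q *ℤ m) + (- q) *ℤ m
  flip-multiple = solve-∀
  add-multiples : ∀ z r q m → (z + r *ℤ m) + q *ℤ m ≡ z + (q + r) *ℤ m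
  add-multiples = solve-∀
  sum-multiples : ∀ x q y r m →
    (x + q *ℤ m) + (y + r *ℤ m) ≡ (x + y) + (q + r) *ℤ m
  sum-multiples = solve-∀
  product-multiples : ∀ x q y r m →
    (x + q *ℤ m) *ℤ (y + r *ℤ m) ≡ x *ℤ y + (q *ℤ y + x *ℤ r + q *ℤ r *ℤ m) *ℤ m
  product-multiples = solve-∀
  negate-multiple : ∀ x q m → - (x + q *ℤ m) ≡ - x + (- q) *ℤ m
  negate-multiple = solve-∀
  modulus-minus : ∀ x m → m + - x ≡ - x + + 1 *ℤ m
  modulus-minus = solve-∀
  zero-as-multiple : ∀ m → + 0 ≡ m + (- + 1) *ℤ m
  zero-as-multiple = solve-∀

module Congruence (m : ℤ) where
  infix 4 _≈_
  infix 2 _by_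

  record _≈_ (x y : ℤ) : Set where
    constructor _by_
    field
      quotient : ℤ
      difference : x ≡ y + quotient *ℤ m

  ≈-reflexive : ∀ {x y} → x ≡ y → x ≈ y
  ≈-reflexive {x} refl = + 0 by zero-multiple x m

  ≈-sym : ∀ {x y} → x ≈ y → y ≈ x
  ≈-sym {y = y} (q by refl) = - q by flip-multiple y q m

  ≈-trans : ∀ {x y z} → x ≈ y → y ≈ z → x ≈ z
  ≈-trans {z = z} (q by refl) (r by refl) = q + r by add-multiples z r q m

  +-cong : ∀ {x x′ y y′} → x ≈ x′ → y ≈ y′ → x + y ≈ x′ + y′
  +-cong {x′ = x′} {y′ = y′} (q by refl) (r by refl) =
    q + r by sum-multiples x′ q y′ r m

  *-cong : ∀ {x x′ y y′} → x ≈ x′ → y ≈ y′ → x *ℤ y ≈ x′ *ℤ y′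
  *-cong {x′ = x′} {y′ = y′} (q by refl) (r by refl) =
    q *ℤ y′ + x′ *ℤ r + q *ℤ r *ℤ m by product-multiples x′ q y′ r m

  neg-cong : ∀ {x x′} → x ≈ x′ → - x ≈ - x′
  neg-cong {x′ = x′} (q by refl) = - q by negate-multiple x′ q m

-- ℤ_{2^k}: polynomial identities over ℤ hold for the operations of Defs

module ModularArithmetic (k : ℕ) where
  M : ℕ
  M = 2 ^ k

  instance
    M≢0 : NonZero M
    M≢0 = ℕP.m^n≢0 2 k

  open Congruence (+ M) public

  ι : Zmod k → ℤ
  ι a = + toℕ a

  ι-red : ∀ n → ι (red k n) ≈ + n
  ι-red n = ≈-sym (+ (n / M) by (begin
    + n                                 ≡⟨ cong +_ (m≡m%n+[m/n]*n n M) ⟩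
    + (n % M ℕ.+ n / M * M)             ≡⟨ ℤP.pos-+ (n % M) _ ⟩
    + (n % M) + + (n / M * M)           ≡⟨ cong (λ t → + (n % M) + t) (ℤP.pos-* (n / M) M) ⟩
    + (n % M) + + (n / M) *ℤ + M        ≡⟨ cong (λ t → + t + + (n / M) *ℤ + M) (toℕ-fromℕ< _) ⟨
    ι (red k n) + + (n / M) *ℤ + M      ∎))
    where open ≡-Reasoning

  ι-add : ∀ a b → ι (addZ k a b) ≈ ι a + ι b
  ι-add a b = ≈-trans (ι-red (toℕ a ℕ.+ toℕ b)) (≈-reflexive (ℤP.pos-+ (toℕ a) (toℕ b)))

  ι-mul : ∀ a b → ι (mulZ k a b) ≈ ι a *ℤ ι b
  ι-mul a b = ≈-trans (ι-red (toℕ a * toℕ b)) (≈-reflexive (ℤP.pos-* (toℕ a) (toℕ b)))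

  ι-neg : ∀ a → ι (negZ k a) ≈ - ι a
  ι-neg a = ≈-trans (ι-red (M ℕ.∸ toℕ a))
    (≈-trans (≈-reflexive M∸a) (+ 1 by modulus-minus (ι a) (+ M)))
    where
      M∸a : + (M ℕ.∸ toℕ a) ≡ + M + - ι a
      M∸a = trans (sym (ℤP.⊖-≥ (ℕP.<⇒≤ (toℕ<n a)))) (sym (ℤP.m-n≡m⊖n M (toℕ a)))

  private
    no-wrap : ∀ (a b : Zmod k) n → ¬ (ι a ≡ ι b + + suc n *ℤ + M)
    no-wrap a b n e = ℕP.<⇒≱ (toℕ<n a) (begin
      M                          ≤⟨ ℕP.m≤m+n M (n * M) ⟩
      suc n * M                  ≤⟨ ℕP.m≤n+m (suc n * M) (toℕ b) ⟩
      toℕ b ℕ.+ suc n * M        ≡⟨ ℤP.+-injective (trans e (trans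
                                      (cong (λ t → ι b + t) (sym (ℤP.pos-* (suc n) M)))
                                      (sym (ℤP.pos-+ (toℕ b) _)))) ⟨
      toℕ a                      ∎)
      where open ℕP.≤-Reasoning

  ι-injective : ∀ {a b} → ι a ≈ ι b → a ≡ b
  ι-injective {a} {b} (+ zero by e) =
    toℕ-injective (ℤP.+-injective (trans e (sym (zero-multiple (ι b) (+ M)))))
  ι-injective {a} {b} (+ suc n by e) = ⊥-elim (no-wrap a b n e)
  ι-injective {a} {b} (-[1+ n ] by e) = ⊥-elim (no-wrap b a n
    (trans (flip-multiple (ι b) -[1+ n ] (+ M)) (cong (λ t → t + + suc n *ℤ + M) (sym e))))

  fromℤ : ℤ → Zmod k
  fromℤ (+ n) = red k n
  fromℤ -[1+ n ] = negZ k (red k (suc n))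

  powZ : Zmod k → ℕ → Zmod k
  powZ a zero = oneZ k
  powZ a (suc n) = mulZ k a (powZ a n)

  ⟦_⟧ₘ : ∀ {n} → Polynomial n → Vec (Zmod k) n → Zmod k
  ⟦ S.op S.[+] p q ⟧ₘ ρ = addZ k (⟦ p ⟧ₘ ρ) (⟦ q ⟧ₘ ρ)
  ⟦ S.op S.[*] p q ⟧ₘ ρ = mulZ k (⟦ p ⟧ₘ ρ) (⟦ q ⟧ₘ ρ)
  ⟦ con c ⟧ₘ ρ = fromℤ c
  ⟦ var x ⟧ₘ ρ = lookup ρ x
  ⟦ p S.:^ n ⟧ₘ ρ = powZ (⟦ p ⟧ₘ ρ) n
  ⟦ :- p ⟧ₘ ρ = negZ k (⟦ p ⟧ₘ ρ)

  ⟦⟧ₘ-sound : ∀ {n} (p : Polynomial n) (ρ : Vec (Zmod k) n) → ι (⟦ p ⟧ₘ ρ) ≈ S.⟦ p ⟧ (map ι ρ)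
  ⟦⟧ₘ-sound (S.op S.[+] p q) ρ =
    ≈-trans (ι-add (⟦ p ⟧ₘ ρ) (⟦ q ⟧ₘ ρ)) (+-cong (⟦⟧ₘ-sound p ρ) (⟦⟧ₘ-sound q ρ))
  ⟦⟧ₘ-sound (S.op S.[*] p q) ρ =
    ≈-trans (ι-mul (⟦ p ⟧ₘ ρ) (⟦ q ⟧ₘ ρ)) (*-cong (⟦⟧ₘ-sound p ρ) (⟦⟧ₘ-sound q ρ))
  ⟦⟧ₘ-sound (con (+ n)) ρ = ι-red n
  ⟦⟧ₘ-sound (con -[1+ n ]) ρ = ≈-trans (ι-neg (red k (suc n))) (neg-cong (ι-red (suc n)))
  ⟦⟧ₘ-sound (var x) ρ = ≈-reflexive (sym (lookup-map x ι ρ))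
  ⟦⟧ₘ-sound (p S.:^ zero) ρ = ι-red 1
  ⟦⟧ₘ-sound (p S.:^ suc n) ρ = ≈-trans (ι-mul (⟦ p ⟧ₘ ρ) (powZ (⟦ p ⟧ₘ ρ) n))
    (*-cong (⟦⟧ₘ-sound p ρ) (⟦⟧ₘ-sound (p S.:^ n) ρ))
  ⟦⟧ₘ-sound (:- p) ρ = ≈-trans (ι-neg (⟦ p ⟧ₘ ρ)) (neg-cong (⟦⟧ₘ-sound p ρ))

  -- Transfer principle: two polynomials with the same normal form over ℤ
  -- (checked by `refl`) evaluate to the same element of ℤ_M.
  identity : ∀ {n} (p q : Polynomial n) (ρ : Vec (Zmod k) n) →
    S.⟦ p ⟧↓ (map ι ρ) ≡ S.⟦ q ⟧↓ (map ι ρ) → ⟦ p ⟧ₘ ρ ≡ ⟦ q ⟧ₘ ρ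
  identity p q ρ p↓≡q↓ = ι-injective (≈-trans (⟦⟧ₘ-sound p ρ)
    (≈-trans (≈-reflexive p≡q) (≈-sym (⟦⟧ₘ-sound q ρ))))
    where
      p≡q : S.⟦ p ⟧ (map ι ρ) ≡ S.⟦ q ⟧ (map ι ρ)
      p≡q = trans (sym (S.correct p (map ι ρ))) (trans p↓≡q↓ (S.correct q (map ι ρ)))

  pos-suc : ∀ n → + suc n ≡ + n + + 1
  pos-suc n = trans (cong +_ (ℕP.+-comm 1 n)) (ℤP.pos-+ n 1)

  ι-csucc : ∀ c → ι (csucc c) ≈ ι c + + 1
  ι-csucc c with csucc-spec c
  ... | inj₁ e = ≈-reflexive (trans (cong +_ e) (pos-suc (toℕ c)))
  ... | inj₂ (e , last) = ≈-trans (≈-reflexive (cong +_ e)) (≈-trans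
        (- + 1 by zero-as-multiple (+ M))
        (≈-reflexive (trans (cong +_ (sym last)) (pos-suc (toℕ c)))))

  csucc≡+1 : ∀ c → csucc c ≡ addZ k c (oneZ k)
  csucc≡+1 c = ι-injective (≈-trans (ι-csucc c)
    (≈-sym (≈-trans (ι-add c (oneZ k)) (+-cong (≈-reflexive {ι c} refl) (ι-red 1)))))

  x₀ : ∀ {n} → Polynomial (suc n)
  x₁ : ∀ {n} → Polynomial (suc (suc n))
  x₂ : ∀ {n} → Polynomial (suc (suc (suc n)))
  x₀ = var zero
  x₁ = var (suc zero)
  x₂ = var (suc (suc zero))

  sub-add : ∀ a w → addZ k (addZ k a (negZ k w)) w ≡ a
  sub-add a w = identity ((x₀ :+ :- x₁) :+ x₁) x₀ (a ∷ w ∷ []) refl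

  add-sub : ∀ a w → addZ k (addZ k a w) (negZ k w) ≡ a
  add-sub a w = identity ((x₀ :+ x₁) :+ :- x₁) x₀ (a ∷ w ∷ []) refl

  add-successor-multiple : ∀ a s e →
    addZ k a (mulZ k (addZ k s (oneZ k)) e) ≡ addZ k (addZ k a (mulZ k s e)) e
  add-successor-multiple a s e =
    identity (x₀ :+ ((x₁ :+ con (+ 1)) :* x₂)) ((x₀ :+ (x₁ :* x₂)) :+ x₂) (a ∷ s ∷ e ∷ []) refl

-- Identities in 𝔑 = ℤ_M[x]/⟨x²+x+1⟩

Expr𝔑 : ℕ → Set
Expr𝔑 n = Polynomial n × Polynomial n

-- The operations of Defs, mirrored on expressions, so that evaluating an
-- expression computes definitionally to the corresponding element of 𝔑.
module Expr𝔑-Operations {n : ℕ} where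
  infixl 6 _+ᴱ_ _-ᴱ_
  infixl 7 _*ᴱ_

  _+ᴱ_ : Expr𝔑 n → Expr𝔑 n → Expr𝔑 n
  (a , b) +ᴱ (c , d) = a :+ c , b :+ d

  -ᴱ_ : Expr𝔑 n → Expr𝔑 n
  -ᴱ (a , b) = :- a , :- b

  _-ᴱ_ : Expr𝔑 n → Expr𝔑 n → Expr𝔑 n
  u -ᴱ v = u +ᴱ (-ᴱ v)

  _*ᴱ_ : Expr𝔑 n → Expr𝔑 n → Expr𝔑 n
  (a , b) *ᴱ (c , d) = (a :* c) :+ :- (b :* d) , ((a :* d) :+ (b :* c)) :+ :- (b :* d)

  xᴱ : Expr𝔑 n
  xᴱ = con (+ 0) , con (+ 1)

  fᴱ : Expr𝔑 n → Expr𝔑 n → Expr𝔑 n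
  fᴱ γ y = xᴱ *ᴱ y +ᴱ γ

module 𝔑-Identities (k : ℕ) where
  open ModularArithmetic k
  open Expr𝔑-Operations

  -- The operations of 𝔑 k with k fixed (k cannot be inferred from 𝔑 k).
  infixl 6 _⊕_ _⊖_
  infixl 7 _⊛_
  _⊕_ _⊖_ _⊛_ : 𝔑 k → 𝔑 k → 𝔑 k
  _⊕_ = _+R_ {k}
  _⊖_ = _-R_ {k}
  _⊛_ = _*R_ {k}

  fₖ : 𝔑 k → 𝔑 k → 𝔑 k
  fₖ = f {k}

  ⟦_⟧ᴿ : ∀ {n} → Expr𝔑 n → Vec (Zmod k) n → 𝔑 k
  ⟦ a , b ⟧ᴿ ρ = ⟦ a ⟧ₘ ρ , ⟦ b ⟧ₘ ρ

  𝔑-identity : ∀ {n} (u v : Expr𝔑 n) (ρ : Vec (Zmod k) n) →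
    S.⟦ proj₁ u ⟧↓ (map ι ρ) ≡ S.⟦ proj₁ v ⟧↓ (map ι ρ) →
    S.⟦ proj₂ u ⟧↓ (map ι ρ) ≡ S.⟦ proj₂ v ⟧↓ (map ι ρ) → ⟦ u ⟧ᴿ ρ ≡ ⟦ v ⟧ᴿ ρ
  𝔑-identity (a , b) (c , d) ρ a≡c b≡d = cong₂ _,_ (identity a c ρ a≡c) (identity b d ρ b≡d)

  Y Γ Δ : Expr𝔑 6
  Y = var zero , var (suc zero)
  Γ = var (suc (suc zero)) , var (suc (suc (suc zero)))
  Δ = var (suc (suc (suc (suc zero)))) , var (suc (suc (suc (suc (suc zero)))))

  env : 𝔑 k → 𝔑 k → 𝔑 k → Vec (Zmod k) 6
  env (y₁ , y₂) (γ₁ , γ₂) (δ₁ , δ₂) = y₁ ∷ y₂ ∷ γ₁ ∷ γ₂ ∷ δ₁ ∷ δ₂ ∷ []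

  -- Since x³ = 1, the map f_γ has the inverse g_γ(w) = x² (w - γ).
  g : 𝔑 k → 𝔑 k → 𝔑 k
  g γ w = (xR {k} ⊛ xR {k}) ⊛ (w ⊖ γ)

  f∘g : ∀ γ w → fₖ γ (g γ w) ≡ w
  f∘g γ w = 𝔑-identity (fᴱ Γ ((xᴱ *ᴱ xᴱ) *ᴱ (Y -ᴱ Γ))) Y (env w γ γ) refl refl

  g∘f : ∀ γ y → g γ (fₖ γ y) ≡ y
  g∘f γ y = 𝔑-identity ((xᴱ *ᴱ xᴱ) *ᴱ (fᴱ Γ Y -ᴱ Γ)) Y (env y γ γ) refl refl

  -- Three steps f_α, f_α, f_β translate by β - α, because x³ = 1, x² + x = -1.
  three-steps : ∀ α β z → fₖ β (fₖ α (fₖ α z)) ≡ z ⊕ (β ⊖ α)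
  three-steps α β z = 𝔑-identity (fᴱ Δ (fᴱ Γ (fᴱ Γ Y))) (Y +ᴱ (Δ -ᴱ Γ)) (env z α β) refl refl

  translate-by-zero : ∀ α z → z ⊕ (α ⊖ α) ≡ z
  translate-by-zero α z = 𝔑-identity (Y +ᴱ (Γ -ᴱ Γ)) Y (env z α α) refl refl

-- Cycle decompositions of maps

record IsBijection {X Y : Set} (h : X → Y) : Set where
  field
    inverse : Y → X
    right   : ∀ y → h (inverse y) ≡ y
    left    : ∀ x → inverse (h x) ≡ x

-- A decomposition of T : X → X into m cycles of length ℓ: a bijection
-- Fin m × Fin ℓ ≅ X along which T becomes (j , i) ↦ (j , i + 1).
record CycleDecomposition {X : Set} (T : X → X) (m ℓ : ℕ) : Set where
  field
    cyc      : Fin m → Fin ℓ → X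
    pos      : X → Fin m × Fin ℓ
    cyc∘pos  : ∀ x → cyc (proj₁ (pos x)) (proj₂ (pos x)) ≡ x
    pos∘cyc  : ∀ j i → pos (cyc j i) ≡ (j , i)
    cyc-step : ∀ j i → cyc j (csucc i) ≡ T (cyc j i)

graph-cycleUnion : ∀ {V : Set} {A : V → V → Set} {T : V → V} {m ℓ} →
  (∀ u v → A u v ⇔ v ≡ T u) → CycleDecomposition T m ℓ → IsCycleUnion A ℓ
graph-cycleUnion {V} {A} {T} {m} {ℓ} graph D =
  record { m = m ; cyc = cyc ; cover = cover ; arcs = arcs }
  where
    open CycleDecomposition D

    cover : ∀ v → Σ (Fin m × Fin ℓ) λ p → (cyc (proj₁ p) (proj₂ p) ≡ v) ×
              (∀ q → cyc (proj₁ q) (proj₂ q) ≡ v → q ≡ p)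
    cover v = pos v , cyc∘pos v ,
      λ (j , i) cyc≡v → trans (sym (pos∘cyc j i)) (cong pos cyc≡v)

    OnCycle : V → V → Set
    OnCycle u v = Σ (Fin m × Fin ℓ) λ p →
      (u ≡ cyc (proj₁ p) (proj₂ p)) × (v ≡ cyc (proj₁ p) (csucc (proj₂ p)))

    arcs : ∀ u v → A u v ⇔ OnCycle u v
    arcs u v = mk⇔ to from
      where
        to : A u v → OnCycle u v
        to a = pos u , sym (cyc∘pos u) , (begin
          v                                             ≡⟨ Equivalence.to (graph u v) a ⟩
          T u                                           ≡⟨ cong T (cyc∘pos u) ⟨
          T (cyc (proj₁ (pos u)) (proj₂ (pos u)))       ≡⟨ cyc-step _ _ ⟨
          cyc (proj₁ (pos u)) (csucc (proj₂ (pos u)))   ∎)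
          where open ≡-Reasoning
        from : OnCycle u v → A u v
        from ((j , i) , u≡ , v≡) = Equivalence.from (graph u v)
          (trans v≡ (trans (cyc-step j i) (cong T (sym u≡))))

conjugate : ∀ {X Y : Set} {T : X → X} {T′ : Y → Y} {m ℓ} {h : X → Y} →
  IsBijection h → (∀ x → h (T x) ≡ T′ (h x)) →
  CycleDecomposition T m ℓ → CycleDecomposition T′ m ℓ
conjugate {h = h} h-bij h∘T D = record
  { cyc      = λ j i → h (cyc j i)
  ; pos      = λ y → pos (inverse y)
  ; cyc∘pos  = λ y → trans (cong h (cyc∘pos (inverse y))) (right y)
  ; pos∘cyc  = λ j i → trans (cong pos (left (cyc j i))) (pos∘cyc j i)
  ; cyc-step = λ j i → trans (cong h (cyc-step j i)) (h∘T (cyc j i))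
  }
  where
    open CycleDecomposition D
    open IsBijection h-bij

fixedPointCycles : ∀ {X : Set} {T : X → X} {m} {enum : Fin m → X} →
  IsBijection enum → (∀ x → T x ≡ x) → CycleDecomposition T m 1
fixedPointCycles {enum = enum} enum-bij fixed = record
  { cyc      = λ j _ → enum j
  ; pos      = λ x → inverse x , zero
  ; cyc∘pos  = right
  ; pos∘cyc  = λ { j zero → cong (_, zero) (left j) }
  ; cyc-step = λ j _ → sym (fixed (enum j))
  }
  where open IsBijection enum-bij

layerStep : ∀ {X : Set} → (Fin 3 → X → X) → Fin 3 × X → Fin 3 × X
layerStep F (i , y) = csucc i , F i y

returnMap : ∀ {X : Set} → (Fin 3 → X → X) → X → X
returnMap F y = F (suc (suc zero)) (F (suc zero) (F zero y))

climb : ∀ {X : Set} → (Fin 3 → X → X) → Fin 3 → X → X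
climb F zero y = y
climb F (suc zero) y = F zero y
climb F (suc (suc zero)) y = F (suc zero) (F zero y)

climb-bijection : ∀ {X : Set} {F : Fin 3 → X → X} →
  IsBijection (F zero) → IsBijection (F (suc zero)) → ∀ r → IsBijection (climb F r)
climb-bijection F₀-bij F₁-bij zero =
  record { inverse = λ w → w ; right = λ _ → refl ; left = λ _ → refl }
climb-bijection F₀-bij F₁-bij (suc zero) = F₀-bij
climb-bijection {F = F} F₀-bij F₁-bij (suc (suc zero)) = record
  { inverse = λ w → F₀.inverse (F₁.inverse w)
  ; right   = λ w → trans (cong (F (suc zero)) (F₀.right _)) (F₁.right w)
  ; left    = λ y → trans (cong F₀.inverse (F₁.left _)) (F₀.left y)
  }
  where
    module F₀ = IsBijection F₀-bij
    module F₁ = IsBijection F₁-bij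

-- If the maps out of layers 0 and 1 are bijections, every cycle of length N
-- of the return map lifts to a cycle of length 3N of layerStep; the position
-- combine n r ∈ Fin (N * 3) is the vertex in layer r above the n-th point.
lift-cycles : ∀ {X : Set} {F : Fin 3 → X → X} {m N} →
  IsBijection (F zero) → IsBijection (F (suc zero)) →
  CycleDecomposition (returnMap F) m N → CycleDecomposition (layerStep F) m (N * 3)
lift-cycles {X} {F} {m} {N} F₀-bij F₁-bij D = record
  { cyc = cyc′ ; pos = pos′ ; cyc∘pos = cyc∘pos′ ; pos∘cyc = pos∘cyc′ ; cyc-step = cyc-step′ }
  where
    open CycleDecomposition D
    open module Climb r = IsBijection (climb-bijection {F = F} F₀-bij F₁-bij r)
      using () renaming (inverse to descend; right to climb∘descend; left to descend∘climb)

    at : Fin m → Fin N → Fin 3 → Fin 3 × X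
    at j n r = r , climb F r (cyc j n)

    cyc′ : Fin m → Fin (N * 3) → Fin 3 × X
    cyc′ j i = uncurry (at j) (remQuot 3 i)

    place : Fin 3 → Fin m × Fin N → Fin m × Fin (N * 3)
    place r (j , n) = j , combine n r

    pos′ : Fin 3 × X → Fin m × Fin (N * 3)
    pos′ (r , w) = place r (pos (descend r w))

    cyc′-combine : ∀ j n r → cyc′ j (combine n r) ≡ at j n r
    cyc′-combine j n r = cong (uncurry (at j)) (remQuot-combine n r)

    cyc∘pos′ : ∀ v → uncurry cyc′ (pos′ v) ≡ v
    cyc∘pos′ (r , w) = trans (cyc′-combine _ _ r)
      (cong (r ,_) (trans (cong (climb F r) (cyc∘pos (descend r w))) (climb∘descend r w)))

    pos∘cyc′ : ∀ j i → pos′ (cyc′ j i) ≡ (j , i)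
    pos∘cyc′ j i = begin
      place r (pos (descend r (climb F r (cyc j n))))
        ≡⟨ cong (λ y → place r (pos y)) (descend∘climb r (cyc j n)) ⟩
      place r (pos (cyc j n))                          ≡⟨ cong (place r) (pos∘cyc j n) ⟩
      j , combine n r                                  ≡⟨ cong (j ,_) (combine-remQuot {N} 3 i) ⟩
      j , i                                            ∎
      where
        open ≡-Reasoning
        n = proj₁ (remQuot {N} 3 i)
        r = proj₂ (remQuot {N} 3 i)

    -- Within a column we climb one layer; from the top layer the return map
    -- moves on to the next point of the cycle.
    at-step : ∀ j n r → uncurry (at j) (csucc-digits n r) ≡ layerStep F (at j n r)
    at-step j n zero = refl
    at-step j n (suc zero) = refl
    at-step j n (suc (suc zero)) = cong (zero ,_) (cyc-step j n)

    cyc-step-combine : ∀ j n r →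
      cyc′ j (csucc (combine n r)) ≡ layerStep F (cyc′ j (combine n r))
    cyc-step-combine j n r = begin
      cyc′ j (csucc (combine n r))                 ≡⟨ cong (cyc′ j) (csucc-combine n r) ⟩
      cyc′ j (uncurry combine (csucc-digits n r))  ≡⟨ uncurry (cyc′-combine j) (csucc-digits n r) ⟩
      uncurry (at j) (csucc-digits n r)            ≡⟨ at-step j n r ⟩
      layerStep F (at j n r)                       ≡⟨ cong (layerStep F) (cyc′-combine j n r) ⟨
      layerStep F (cyc′ j (combine n r))           ∎
      where open ≡-Reasoning

    cyc-step′ : ∀ j i → cyc′ j (csucc i) ≡ layerStep F (cyc′ j i)
    cyc-step′ j i = subst (λ i → cyc′ j (csucc i) ≡ layerStep F (cyc′ j i))
      (combine-remQuot {N} 3 i) (uncurry (cyc-step-combine j) (remQuot 3 i))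

-- Cycles of the return map of H_{4^k}(α,β)

module ReturnMapCycles (k : ℕ) where
  open ModularArithmetic k
  open 𝔑-Identities k

  𝔑-enumeration : IsBijection (remQuot {M} M)
  𝔑-enumeration = record
    { inverse = uncurry combine
    ; right   = λ (z₁ , z₂) → remQuot-combine z₁ z₂
    ; left    = combine-remQuot {M} M
    }

  _·_ : Zmod k → 𝔑 k → 𝔑 k
  s · (d₁ , d₂) = mulZ k s d₁ , mulZ k s d₂

  -- If the first coordinate e₁ of Δ is invertible, a map T acting as
  -- translation by Δ has the 2^k cycles  s ↦ (0 , j) + s·Δ  (j ∈ ℤ_M),
  -- each of length 2^k; the point z lies on the one with s = e₁⁻¹ z₁.
  translationCycles : ∀ {T : 𝔑 k → 𝔑 k} (Δ : 𝔑 k) (u : Zmod k) →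
    mulZ k u (proj₁ Δ) ≡ oneZ k → (∀ z → T z ≡ z ⊕ Δ) → CycleDecomposition T M M
  translationCycles {T} (e₁ , e₂) u u·e₁≡1 T≡+Δ = record
    { cyc = cyc ; pos = pos ; cyc∘pos = cyc∘pos ; pos∘cyc = pos∘cyc ; cyc-step = cyc-step }
    where
      cyc : Zmod k → Zmod k → 𝔑 k
      cyc j s = (zeroZ k , j) ⊕ s · (e₁ , e₂)

      pos : 𝔑 k → Zmod k × Zmod k
      pos (z₁ , z₂) = addZ k z₂ (negZ k (mulZ k (mulZ k u z₁) e₂)) , mulZ k u z₁

      scale-unit : ∀ s → mulZ k s (mulZ k u e₁) ≡ s
      scale-unit s =
        trans (cong (mulZ k s) u·e₁≡1) (identity (x₀ :* con (+ 1)) x₀ (s ∷ []) refl)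

      recover-parameter : ∀ s → mulZ k u (addZ k (zeroZ k) (mulZ k s e₁)) ≡ s
      recover-parameter s = trans
        (identity (x₁ :* (con (+ 0) :+ (x₀ :* x₂))) (x₀ :* (x₁ :* x₂)) (s ∷ u ∷ e₁ ∷ []) refl)
        (scale-unit s)

      recover-coordinate : ∀ z₁ → addZ k (zeroZ k) (mulZ k (mulZ k u z₁) e₁) ≡ z₁
      recover-coordinate z₁ = trans
        (identity (con (+ 0) :+ ((x₁ :* x₀) :* x₂)) (x₀ :* (x₁ :* x₂)) (z₁ ∷ u ∷ e₁ ∷ []) refl)
        (scale-unit z₁)

      cyc∘pos : ∀ z → uncurry cyc (pos z) ≡ z
      cyc∘pos (z₁ , z₂) =
        cong₂ _,_ (recover-coordinate z₁) (sub-add z₂ (mulZ k (mulZ k u z₁) e₂))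

      pos∘cyc : ∀ j s → pos (cyc j s) ≡ (j , s)
      pos∘cyc j s = cong₂ _,_ (trans (cong shift-back (recover-parameter s))
        (add-sub j (mulZ k s e₂))) (recover-parameter s)
        where
          shift-back : Zmod k → Zmod k
          shift-back s′ = addZ k (addZ k j (mulZ k s e₂)) (negZ k (mulZ k s′ e₂))

      cyc-step : ∀ j s → cyc j (csucc s) ≡ T (cyc j s)
      cyc-step j s = begin
        cyc j (csucc s)                  ≡⟨ cong (cyc j) (csucc≡+1 s) ⟩
        cyc j (addZ k s (oneZ k))        ≡⟨ cong₂ _,_ (add-successor-multiple (zeroZ k) s e₁)
                                                      (add-successor-multiple j s e₂) ⟩
        cyc j s ⊕ (e₁ , e₂)              ≡⟨ T≡+Δ (cyc j s) ⟨
        T (cyc j s)                      ∎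
        where open ≡-Reasoning

  SelfInverse : Zmod k → Set
  SelfInverse e = mulZ k e e ≡ oneZ k

  -- Translation by Δ has 2^k cycles of length 2^k as soon as one coordinate
  -- of Δ is self-inverse; the case of the second coordinate reduces to
  -- translationCycles by conjugating with the coordinate swap.
  unitCoordinateCycles : ∀ {T : 𝔑 k → 𝔑 k} (Δ : 𝔑 k) →
    SelfInverse (proj₁ Δ) ⊎ SelfInverse (proj₂ Δ) → (∀ z → T z ≡ z ⊕ Δ) →
    CycleDecomposition T M M
  unitCoordinateCycles Δ (inj₁ e₁²≡1) T≡+Δ = translationCycles Δ (proj₁ Δ) e₁²≡1 T≡+Δ
  unitCoordinateCycles {T} Δ (inj₂ e₂²≡1) T≡+Δ =
    conjugate swap-bijection (λ _ → refl)
      (translationCycles {λ z → swap (T (swap z))} (swap Δ) (proj₂ Δ) e₂²≡1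
        (λ z → cong swap (T≡+Δ (swap z))))
    where
      swap-bijection : IsBijection (swap {A = Zmod k} {B = Zmod k})
      swap-bijection = record { inverse = swap ; right = λ _ → refl ; left = λ _ → refl }

  constant-self-inverse : (e : Polynomial 0) →
    S.⟦ e :* e ⟧↓ [] ≡ S.⟦ con (+ 1) ⟧↓ [] → SelfInverse (⟦ e ⟧ₘ [])
  constant-self-inverse e = identity (e :* e) (con (+ 1)) []

  -- Each of ±1, ±x, ±x±1 has a coordinate ±1, which is self-inverse.
  special-coordinate : ∀ d → d ∈ specialDiffs {k} →
    SelfInverse (proj₁ d) ⊎ SelfInverse (proj₂ d)
  special-coordinate _ (here refl) = inj₁ (constant-self-inverse (con (+ 1)) refl)
  special-coordinate _ (there (here refl)) = inj₁ (constant-self-inverse (:- con (+ 1)) refl)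
  special-coordinate _ (there (there (here refl))) = inj₂ (constant-self-inverse (con (+ 1)) refl)
  special-coordinate _ (there (there (there (here refl)))) =
    inj₂ (constant-self-inverse (:- con (+ 1)) refl)
  special-coordinate _ (there (there (there (there (here refl))))) =
    inj₁ (constant-self-inverse (con (+ 0) :+ con (+ 1)) refl)
  special-coordinate _ (there (there (there (there (there (here refl)))))) =
    inj₁ (constant-self-inverse (con (+ 0) :+ :- con (+ 1)) refl)
  special-coordinate _ (there (there (there (there (there (there (here refl))))))) =
    inj₁ (constant-self-inverse (:- con (+ 0) :+ con (+ 1)) refl)
  special-coordinate _ (there (there (there (there (there (there (there (here refl)))))))) =
    inj₁ (constant-self-inverse (:- con (+ 0) :+ :- con (+ 1)) refl)
  special-coordinate _ (there (there (there (there (there (there (there (there ()))))))))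

  -- (b - a)² = (a - b)²: self-inverse coordinates of α - β are those of β - α.
  flip-difference : ∀ x y →
    SelfInverse (addZ k x (negZ k y)) → SelfInverse (addZ k y (negZ k x))
  flip-difference x y = trans (identity ((x₁ :+ :- x₀) :* (x₁ :+ :- x₀))
    ((x₀ :+ :- x₁) :* (x₀ :+ :- x₁)) (x ∷ y ∷ []) refl)

  specialReturnCycles : ∀ α β → α ⊖ β ∈ specialDiffs {k} →
    CycleDecomposition (λ z → fₖ β (fₖ α (fₖ α z))) M M
  specialReturnCycles α β α-β∈ = unitCoordinateCycles (β ⊖ α) flipped (three-steps α β)
    where
      flipped : SelfInverse (proj₁ (β ⊖ α)) ⊎ SelfInverse (proj₂ (β ⊖ α))
      flipped with special-coordinate (α ⊖ β) α-β∈
      ... | inj₁ e = inj₁ (flip-difference (proj₁ α) (proj₁ β) e)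
      ... | inj₂ e = inj₂ (flip-difference (proj₂ α) (proj₂ β) e)

module LayerGraph (k : ℕ) where
  open 𝔑-Identities k

  layers : 𝔑 k → 𝔑 k → Fin 3 → 𝔑 k → 𝔑 k
  layers α β i = fₖ (γH {k} α β i)

  H-graph : ∀ α β u v → H k α β u v ⇔ v ≡ layerStep (layers α β) u
  H-graph α β u v =
    mk⇔ (λ (j≡ , z≡) → cong₂ _,_ j≡ z≡) (λ v≡ → cong proj₁ v≡ , cong proj₂ v≡)

  f-bijection : ∀ γ → IsBijection (fₖ γ)
  f-bijection γ = record { inverse = g γ ; right = f∘g γ ; left = g∘f γ }

  H-factor : ∀ α β {m N} → CycleDecomposition (λ z → fₖ β (fₖ α (fₖ α z))) m N →
    IsCFactorOf (N * 3) (H k α β) (C4k3 k)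
  H-factor α β D =
    (λ _ _ → proj₁) ,
    graph-cycleUnion (H-graph α β) (lift-cycles (f-bijection α) (f-bijection α) D)

lemma3p3 : (k : ℕ) → k ≥ 1 → (α β : 𝔑 k) →
    (α ≡ β → IsCFactorOf 3 (H k α β) (C4k3 k)) ×
    (_-R_ {k} α β ∈ specialDiffs {k} → IsCFactorOf (3 * 2 ^ k) (H k α β) (C4k3 k))
lemma3p3 k _ α β = equal-case , special-case
  where
    open 𝔑-Identities k
    open ReturnMapCycles k
    open LayerGraph k

    -- For α = β the return map is the identity: 4^k cycles of length 3.
    equal-case : α ≡ β → IsCFactorOf 3 (H k α β) (C4k3 k)
    equal-case refl = H-factor α α
      (fixedPointCycles 𝔑-enumeration (λ z → trans (three-steps α α z) (translate-by-zero α z)))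

    -- For α - β ∈ {±1, ±x, ±x±1} it is a translation with 2^k cycles of length 2^k.
    special-case : α ⊖ β ∈ specialDiffs {k} → IsCFactorOf (3 * 2 ^ k) (H k α β) (C4k3 k)
    special-case α-β∈ = subst (λ ℓ → IsCFactorOf ℓ (H k α β) (C4k3 k)) (ℕP.*-comm (2 ^ k) 3)
      (H-factor α β (specialReturnCycles α β α-β∈))
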